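{- Every 5-basket is $(2P_3,C_4,C_6,C_7,T_0)$-free and contains an induced 3-pentagon. Moreover, every 5-basket is anticonnected and contains no simplicial and no universal vertices.
   Context: All graphs are finite, simple and nonnull. $G$ is $H$-free if no induced subgraph is isomorphic to $H$. $C_k$: cycle on $k$ vertices; $2P_3$: disjoint union of two 3-vertex paths. $T_0$ is the graph with vertex set $\{p,p',q_0,q_1,q_2,q_3,r_1,r_2,r_3\}$ and exactly the edges $pp',pq_0,pq_2,pq_3,p'q_1,p'q_2,p'q_3,q_0r_1,q_1r_1,q_2r_2,q_3r_3,r_1r_2,r_1r_3,r_2r_3$. The 3-pentagon has vertices $a,b_1,b_2,b_3,c_1,c_2,c_3$, with $a$ adjacent to all $b_i$ and no $c_i$, the $b_i$ pairwise nonadjacent, the $c_i$ pairwise adjacent, and $b_ic_j$ an edge iff $i=j$. Clique: possibly empty set of pairwise adjacent vertices; simplicial vertex: neighborhood is a clique; universal vertex: adjacent to all others; anticonnected: complement is connected. Complete/anticomplete: every vertex of one set adjacent/nonadjacent to every vertex of the other. 5-basket: a graph $Q$ whose vertex set is partitioned into $A,B_1,B_2,B_3,C_1,C_2,C_3,F$ where $A,B_i,C_i$ are nonempty cliques and $F$ is a possibly empty clique; $B_1,B_2,B_3$ pairwise anticomplete; $C_1,C_2,C_3$ pairwise complete; for some $i^*\in\{1,2,3\}$, $A$ is complete to $(B_1\cup B_2\cup B_3)\setminus B_{i^*}$ and $A$ can be ordered $a_1,\dots,a_m$ with $N(a_m)\cap B_{i^*}\subseteq\dots\subseteq N(a_1)\cap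 B_{i^*}=B_{i^*}$; $A$ anticomplete to $C_1\cup C_2\cup C_3$; each $B_i$ complete to $C_i$ and anticomplete to $C_j$ for $j\ne i$; for some $j^*\in\{1,2,3\}$, $F$ complete to $V(Q)\setminus(B_{j^*}\cup C_{j^*}\cup F)$ and anticomplete to $B_{j^*}\cup C_{j^*}$. -}

module Defs where

open import Data.Nat using (ℕ; zero; suc; _<_)
open import Data.Fin using (Fin; #_; _≟_) renaming (zero to fzero; _≤_ to _≤ᶠ_)
open import Data.Bool using (Bool; true; false; _∧_; _∨_; not)
open import Data.List using (List; []; _∷_)
open import Data.Bool.ListAction using (any)
open import Data.Product using (Σ; ∃; _×_; _,_)
open import Relation.Nullary using (¬_)
open import Relation.Nullary.Decidable using (⌊_⌋)
open import Relation.Binary.PropositionalEquality using (_≡_; _≢_)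
open import Function.Definitions using (Injective)

record Graph : Set where
  field
    n       : ℕ
    nonnull : 0 < n
    adj     : Fin n → Fin n → Bool
    sym     : ∀ u v → adj u v ≡ adj v u
    irrefl  : ∀ v → adj v v ≡ false

open Graph public



E : (G : Graph) → Fin (n G) → Fin (n G) → Set
E G u v = adj G u v ≡ true

fromEdges : {k : ℕ} → List (Fin k × Fin k) → Fin k → Fin k → Bool
fromEdges es i j =
  any (λ { (a , b) → (⌊ a ≟ i ⌋ ∧ ⌊ b ≟ j ⌋) ∨ (⌊ a ≟ j ⌋ ∧ ⌊ b ≟ i ⌋) }) es

-- G contains an induced subgraph isomorphic to the graph on Fin k with
-- adjacency h (h symmetric and loopless)
InducedCopy : {k : ℕ} → (Fin k → Fin k → Bool) → Graph → Set
InducedCopy {k} h G =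
  Σ (Fin k → Fin (n G)) λ f →
    Injective _≡_ _≡_ f × (∀ i j → i ≢ j → adj G (f i) (f j) ≡ h i j)

Free : {k : ℕ} → (Fin k → Fin k → Bool) → Graph → Set
Free h G = ¬ InducedCopy h G

twoP3 : Fin 6 → Fin 6 → Bool
twoP3 = fromEdges ((# 0 , # 1) ∷ (# 1 , # 2) ∷ (# 3 , # 4) ∷ (# 4 , # 5) ∷ [])

C4 : Fin 4 → Fin 4 → Bool
C4 = fromEdges ((# 0 , # 1) ∷ (# 1 , # 2) ∷ (# 2 , # 3) ∷ (# 3 , # 0) ∷ [])

C6 : Fin 6 → Fin 6 → Bool
C6 = fromEdges ((# 0 , # 1) ∷ (# 1 , # 2) ∷ (# 2 , # 3) ∷ (# 3 , # 4)
              ∷ (# 4 , # 5) ∷ (# 5 , # 0) ∷ [])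

C7 : Fin 7 → Fin 7 → Bool
C7 = fromEdges ((# 0 , # 1) ∷ (# 1 , # 2) ∷ (# 2 , # 3) ∷ (# 3 , # 4)
              ∷ (# 4 , # 5) ∷ (# 5 , # 6) ∷ (# 6 , # 0) ∷ [])

-- T0 : p=0, p'=1, q0=2, q1=3, q2=4, q3=5, r1=6, r2=7, r3=8
T0 : Fin 9 → Fin 9 → Bool
T0 = fromEdges ((# 0 , # 1) ∷ (# 0 , # 2) ∷ (# 0 , # 4) ∷ (# 0 , # 5)
              ∷ (# 1 , # 3) ∷ (# 1 , # 4) ∷ (# 1 , # 5)
              ∷ (# 2 , # 6) ∷ (# 3 , # 6) ∷ (# 4 , # 7) ∷ (# 5 , # 8)
              ∷ (# 6 , # 7) ∷ (# 6 , # 8) ∷ (# 7 , # 8) ∷ [])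

-- 3-pentagon : a=0, b1=1, b2=2, b3=3, c1=4, c2=5, c3=6
pentagon3 : Fin 7 → Fin 7 → Bool
pentagon3 = fromEdges ((# 0 , # 1) ∷ (# 0 , # 2) ∷ (# 0 , # 3)
                     ∷ (# 4 , # 5) ∷ (# 4 , # 6) ∷ (# 5 , # 6)
                     ∷ (# 1 , # 4) ∷ (# 2 , # 5) ∷ (# 3 , # 6) ∷ [])

data Reach {V : Set} (R : V → V → Set) : V → V → Set where
  here  : ∀ {u} → Reach R u u
  there : ∀ {u v w} → R u v → Reach R v w → Reach R u w

Connected : Graph → Set
Connected G = ∀ u v → Reach (E G) u v

coE : (G : Graph) → Fin (n G) → Fin (n G) → Set
coE G u v = u ≢ v × adj G u v ≡ false

Anticonnected : Graph → Set
Anticonnected G = ∀ u v → Reach (coE G) u v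

Simplicial : (G : Graph) → Fin (n G) → Set
Simplicial G v = ∀ x y → E G v x → E G v y → x ≢ y → E G x y

Universal : (G : Graph) → Fin (n G) → Set
Universal G v = ∀ u → u ≢ v → E G v u

data Part : Set where
  A : Part
  B : Fin 3 → Part
  C : Fin 3 → Part
  F : Part

record FiveBasket (G : Graph) : Set where
  field
    part : Fin (n G) → Part
    istar : Fin 3
    jstar : Fin 3
    clique : ∀ X u v → part u ≡ X → part v ≡ X → u ≢ v → E G u v
    A-ne : ∃ λ v → part v ≡ A
    B-ne : ∀ i → ∃ λ v → part v ≡ B i
    C-ne : ∀ i → ∃ λ v → part v ≡ C i
    BB : ∀ i j → i ≢ j → ∀ u v → part u ≡ B i → part v ≡ B j → adj G u v ≡ false
    CC : ∀ i j → i ≢ j → ∀ u v → part u ≡ C i → part v ≡ C j → E G u v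
    AB : ∀ j → j ≢ istar → ∀ u v → part u ≡ A → part v ≡ B j → E G u v
    m     : ℕ
    order : Fin (suc m) → Fin (n G)
    order-inj  : Injective _≡_ _≡_ order
    order-in   : ∀ k → part (order k) ≡ A
    order-onto : ∀ v → part v ≡ A → ∃ λ k → order k ≡ v
    order-mono : ∀ k l → k ≤ᶠ l → ∀ b → part b ≡ B istar →
                 E G (order l) b → E G (order k) b
    order-first : ∀ b → part b ≡ B istar → E G (order fzero) b
    AC : ∀ j u v → part u ≡ A → part v ≡ C j → adj G u v ≡ false
    BC-same : ∀ i u v → part u ≡ B i → part v ≡ C i → E G u v
    BC-diff : ∀ i j → i ≢ j → ∀ u v → part u ≡ B i → part v ≡ C j → adj G u v ≡ false
    F-complete : ∀ u v → part u ≡ F → part v ≢ B jstar → part v ≢ C jstar →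
                 part v ≢ F → E G u v
    F-antiB : ∀ u v → part u ≡ F → part v ≡ B jstar → adj G u v ≡ false
    F-antiC : ∀ u v → part u ≡ F → part v ≡ C jstar → adj G u v ≡ false

{-# OPTIONS --safe #-}
-- In a 5-basket the adjacency of two distinct vertices is determined by the parts containing
-- them, except between A and B_{i*}, where the neighbourhoods of the vertices of A are nested.
-- Both facts pass to induced subgraphs, so an induced copy of 2P3, C4, C6, C7 or T0 would give
-- a labelling of that small graph by parts with the same two properties; an exhaustive search
-- shows that, for every i* and j*, no such labelling exists.
-- The remaining claims use the first vertex a_1 of A, which is complete to every B_i: with one
-- vertex of each B_i and C_i it induces a 3-pentagon, and in the complement every vertex reaches
-- a_1 through a nonneighbour in C.
module Submission where

open import Defs renaming (sym to adj-sym)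
open import Data.Bool using (Bool; true; false; T; not; _∧_; _∨_)
open import Data.Bool.ListAction using (all)
open import Data.Bool.Properties using (T-∧; T-∨; T-≡) renaming (_≟_ to _≟ᵇ_)
open import Data.Fin using (Fin; _≟_; punchIn)
open import Data.Fin.Patterns using (0F; 1F; 2F; 3F; 4F; 5F; 6F)
open import Data.Fin.Properties using (all?; punchInᵢ≢i; punchIn-injective)
  renaming (≤-total to ≤ᶠ-total)
open import Data.List using (List; []; _∷_; _++_; map; allFin)
open import Data.List.Membership.Propositional using (_∈_)
open import Data.List.Membership.Propositional.Properties using (∈-map⁺; ∈-++⁺ˡ; ∈-++⁺ʳ; ∈-allFin)
open import Data.List.Relation.Unary.All using (lookup)
open import Data.List.Relation.Unary.All.Properties using (all⁺)
open import Data.List.Relation.Unary.Any using (here; there)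
open import Data.Nat using (ℕ)
open import Data.Product using (∃; _×_; _,_; proj₁; proj₂)
open import Data.Sum using (_⊎_; inj₁; inj₂; [_,_]′) renaming (map to ⊎-map)
open import Data.Unit using (tt)
open import Function using (_∘_)
open import Function.Bundles using (Equivalence)
open import Function.Definitions using (Injective)
open import Relation.Binary.Definitions using (Symmetric)
open import Relation.Binary.PropositionalEquality
  using (_≡_; _≢_; refl; sym; trans; cong; subst; module ≡-Reasoning)
open import Relation.Nullary using (¬_; Dec; yes; no; does)
open import Relation.Nullary.Decidable using (⌊_⌋; map′; toWitness; fromWitness; T?; ¬?; _→-dec_)

T-not-∨-elim : ∀ {x y} → T (not x ∨ y) → T x → T y
T-not-∨-elim {true} t _ = t

T-not-∨-intro : ∀ {x y} → (x ≡ true → y ≡ true) → T (not x ∨ y)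
T-not-∨-intro {false} _ = tt
T-not-∨-intro {true}  f = subst T (sym (f refl)) tt

T-does-∨ : ∀ {X : Set} {y} (X? : Dec X) → (¬ X → T y) → T (does X? ∨ y)
T-does-∨ (yes _)  _ = tt
T-does-∨ (no ¬x) f = f ¬x

T-not-does-∨ : ∀ {X : Set} {y} (X? : Dec X) → (X → T y) → T (not (does X?) ∨ y)
T-not-does-∨ (yes x) f = f x
T-not-does-∨ (no _)  _ = tt

Reach-++ : ∀ {V : Set} {R : V → V → Set} {u v w} → Reach R u v → Reach R v w → Reach R u w
Reach-++ here        q = q
Reach-++ (there r p) q = there r (Reach-++ p q)

Reach-reverse : ∀ {V : Set} {R : V → V → Set} → Symmetric R → ∀ {u v} → Reach R u v → Reach R v u
Reach-reverse R-sym here        = here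
Reach-reverse R-sym (there r p) = Reach-++ (Reach-reverse R-sym p) (there (R-sym r) here)

connected-via-hub : ∀ {V : Set} {R : V → V → Set} {hub} → Symmetric R →
                    (∀ v → Reach R v hub) → ∀ u v → Reach R u v
connected-via-hub R-sym to-hub u v = Reach-++ (to-hub u) (Reach-reverse R-sym (to-hub v))

adj-swap : ∀ (G : Graph) {u v b} → adj G u v ≡ b → adj G v u ≡ b
adj-swap G = trans (adj-sym G _ _)

coE-sym : ∀ (G : Graph) → Symmetric (coE G)
coE-sym G (u≢v , uv) = u≢v ∘ sym , adj-swap G uv

¬simplicial : ∀ (G : Graph) {v x y} → E G v x → E G v y → x ≢ y → adj G x y ≡ false → ¬ Simplicial G v
¬simplicial G vx vy x≢y xy simplicial with trans (sym (simplicial _ _ vx vy x≢y)) xy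
... | ()

¬universal : ∀ (G : Graph) {u v} → u ≢ v → adj G v u ≡ false → ¬ Universal G v
¬universal G u≢v vu universal with trans (sym (universal _ u≢v)) vu
... | ()

punchIn-0≢1 : ∀ (k : Fin 3) → punchIn k 0F ≢ punchIn k 1F
punchIn-0≢1 k e with punchIn-injective k 0F 1F e
... | ()

B-injective : ∀ {i j} → B i ≡ B j → i ≡ j
B-injective refl = refl

A? : ∀ P → Dec (P ≡ A)
A? A     = yes refl
A? (B _) = no λ ()
A? (C _) = no λ ()
A? F     = no λ ()

B? : ∀ i P → Dec (P ≡ B i)
B? i A     = no λ ()
B? i (B j) = map′ (cong B) B-injective (j ≟ i)
B? i (C _) = no λ ()
B? i F     = no λ ()

parts : List Part
parts = A ∷ F ∷ map B (allFin 3) ++ map C (allFin 3)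

∈-parts : ∀ P → P ∈ parts
∈-parts A     = here refl
∈-parts F     = there (here refl)
∈-parts (B i) = there (there (∈-++⁺ˡ (∈-map⁺ B (∈-allFin i))))
∈-parts (C i) = there (there (∈-++⁺ʳ (map B (allFin 3)) (∈-map⁺ C (∈-allFin i))))

-- The only pairs of parts of a 5-basket with index i* whose adjacency is not determined.
data Open (is : Fin 3) : Part → Part → Set where
  A-B : Open is A (B is)
  B-A : Open is (B is) A

open? : ∀ is P Q → Dec (Open is P Q)
open? is A     (B i) = map′ (λ { refl → A-B }) (λ { A-B → refl }) (i ≟ is)
open? is (B i) A     = map′ (λ { refl → B-A }) (λ { B-A → refl }) (i ≟ is)
open? is A     A     = no λ ()
open? is A     (C _) = no λ ()
open? is A     F     = no λ ()
open? is (B _) (B _) = no λ ()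
open? is (B _) (C _) = no λ ()
open? is (B _) F     = no λ ()
open? is (C _) _     = no λ ()
open? is F     _     = no λ ()

-- Adjacency between distinct vertices of the given parts of a 5-basket with index j*.
-- On Open pairs it is the adjacency of a_1, which is complete to every B_i.
partAdj : Fin 3 → Part → Part → Bool
partAdj js A     A     = true
partAdj js A     (B _) = true
partAdj js A     (C _) = false
partAdj js A     F     = true
partAdj js (B _) A     = true
partAdj js (B i) (B j) = ⌊ i ≟ j ⌋
partAdj js (B i) (C j) = ⌊ i ≟ j ⌋
partAdj js (B i) F     = not ⌊ i ≟ js ⌋
partAdj js (C _) A     = false
partAdj js (C i) (B j) = ⌊ i ≟ j ⌋
partAdj js (C _) (C _) = true
partAdj js (C i) F     = not ⌊ i ≟ js ⌋
partAdj js F     A     = true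
partAdj js F     (B j) = not ⌊ j ≟ js ⌋
partAdj js F     (C j) = not ⌊ j ≟ js ⌋
partAdj js F     F     = true

NbhdSubset : {V : Set} → (V → V → Bool) → (V → Set) → V → V → Set
NbhdSubset adjacent Y a a' = ∀ b → Y b → adjacent a b ≡ true → adjacent a' b ≡ true

distinct-labels : ∀ {V : Set} (label : V → Part) {u v P Q} → label u ≡ P → label v ≡ Q → P ≢ Q → u ≢ v
distinct-labels label pu pv P≢Q u≡v = P≢Q (trans (sym pu) (trans (cong label u≡v) pv))

-- The part of the definition of a 5-basket that passes to induced subgraphs.
record BasketShaped {V : Set} (adjacent : V → V → Bool) (label : V → Part) (is js : Fin 3) : Set where
  field
    adjacent-partAdj : ∀ {u v P Q} → label u ≡ P → label v ≡ Q → u ≢ v → ¬ Open is P Q →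
                       adjacent u v ≡ partAdj js P Q
    A-nested : ∀ {a a'} → label a ≡ A → label a' ≡ A →
               NbhdSubset adjacent (λ b → label b ≡ B is) a a' ⊎
               NbhdSubset adjacent (λ b → label b ≡ B is) a' a

BasketShaped-induced : ∀ {W V : Set} {adjacent : V → V → Bool} {label : V → Part} {is js}
                       {H : W → W → Bool} (f : W → V) → Injective _≡_ _≡_ f →
                       (∀ i j → i ≢ j → adjacent (f i) (f j) ≡ H i j) →
                       BasketShaped adjacent label is js → BasketShaped H (label ∘ f) is js
BasketShaped-induced {adjacent = adjacent} {label} {is} {H = H} f f-inj f-adj shaped = record
  { adjacent-partAdj = λ pu pv u≢v ¬open →
      trans (sym (f-adj _ _ u≢v)) (adjacent-partAdj pu pv (u≢v ∘ f-inj) ¬open)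
  ; A-nested = λ pa pa' → ⊎-map (restrict pa pa') (restrict pa' pa) (A-nested pa pa')
  }
  where
  open BasketShaped shaped
  restrict : ∀ {a a'} → label (f a) ≡ A → label (f a') ≡ A →
             NbhdSubset adjacent (λ b → label b ≡ B is) (f a) (f a') →
             NbhdSubset H (λ b → label (f b) ≡ B is) a a'
  restrict {a} {a'} pa pa' included b pb ab =
    trans (sym (f-adj a' b (distinct-labels (label ∘ f) pa' pb λ ())))
          (included (f b) pb (trans (f-adj a b (distinct-labels (label ∘ f) pa pb λ ())) ab))

assignment : ∀ {V L : Set} → (V → L) → List V → List (V × L)
assignment p = map (λ v → v , p v)

all-assignment : ∀ {V L : Set} {f : V × L → Bool} (p : V → L) →
                 (∀ v → T (f (v , p v))) → ∀ us → T (all f (assignment p us))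
all-assignment p h []       = tt
all-assignment p h (u ∷ us) = Equivalence.from T-∧ (h u , all-assignment p h us)

module Backtracking {V L : Set} (labels : List L) (extendable : List (V × L) → V → L → Bool) where

  noExtension : List V → List (V × L) → Bool
  noExtension []       σ = false
  noExtension (v ∷ vs) σ = all (λ l → not (extendable σ v l) ∨ noExtension vs ((v , l) ∷ σ)) labels

  noExtension-sound : (p : V → L) → (∀ l → l ∈ labels) →
                      (∀ us v → T (extendable (assignment p us) v (p v))) →
                      ∀ vs us → ¬ T (noExtension vs (assignment p us))
  noExtension-sound p complete sound []       us ()
  noExtension-sound p complete sound (v ∷ vs) us t =
    noExtension-sound p complete sound vs (v ∷ us)
      (T-not-∨-elim (lookup (all⁺ _ _ t) (complete (p v))) (sound us v))

module BasketSearch {k : ℕ} (H : Fin k → Fin k → Bool) (is js : Fin 3) where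

  compatible : Fin k → Part → Fin k × Part → Bool
  compatible v P (u , Q) = does (v ≟ u) ∨ does (open? is P Q) ∨ ⌊ H v u ≟ᵇ partAdj js P Q ⌋

  included : List (Fin k × Part) → Fin k → Fin k → Bool
  included σ a a' = all (λ (b , Q) → not (does (B? is Q)) ∨ not (H a b) ∨ H a' b) σ

  nested : List (Fin k × Part) → Bool
  nested σ = all (λ (a , P) → not (does (A? P)) ∨
                   all (λ (a' , P') → not (does (A? P')) ∨ included σ a a' ∨ included σ a' a) σ) σ

  extendable : List (Fin k × Part) → Fin k → Part → Bool
  extendable σ v P = all (compatible v P) σ ∧ nested ((v , P) ∷ σ)

  open Backtracking parts extendable

  refuted : Bool
  refuted = noExtension (allFin k) []

  module _ {p : Fin k → Part} (shaped : BasketShaped H p is js) where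
    open BasketShaped shaped

    compatible-sound : ∀ v u → T (compatible v (p v) (u , p u))
    compatible-sound v u =
      T-does-∨ (v ≟ u) λ v≢u → T-does-∨ (open? is (p v) (p u)) λ ¬open →
        fromWitness (adjacent-partAdj refl refl v≢u ¬open)

    included-sound : ∀ {a a'} → NbhdSubset H (λ b → p b ≡ B is) a a' →
                     ∀ us → T (included (assignment p us) a a')
    included-sound a⊆a' =
      all-assignment p λ b → T-not-does-∨ (B? is (p b)) λ pb → T-not-∨-intro (a⊆a' b pb)

    nested-sound : ∀ us → T (nested (assignment p us))
    nested-sound us =
      all-assignment p (λ a → T-not-does-∨ (A? (p a)) λ pa →
        all-assignment p (λ a' → T-not-does-∨ (A? (p a')) λ pa' →
          [ (λ a⊆a' → Equivalence.from T-∨ (inj₁ (included-sound a⊆a' us)))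
          , (λ a'⊆a → Equivalence.from T-∨ (inj₂ (included-sound a'⊆a us))) ]′ (A-nested pa pa')) us) us

    extendable-sound : ∀ us v → T (extendable (assignment p us) v (p v))
    extendable-sound us v =
      Equivalence.from T-∧ (all-assignment p (compatible-sound v) us , nested-sound (v ∷ us))

  refuted-sound : T refuted → ∀ p → ¬ BasketShaped H p is js
  refuted-sound t p shaped = noExtension-sound p ∈-parts (extendable-sound shaped) (allFin k) [] t

refuted? : ∀ {k} (H : Fin k → Fin k → Bool) → Dec (∀ is js → T (BasketSearch.refuted H is js))
refuted? H = all? λ is → all? λ js → T? _

pentagonPart : Fin 7 → Part
pentagonPart 0F = A
pentagonPart 1F = B 0F
pentagonPart 2F = B 1F
pentagonPart 3F = B 2F
pentagonPart 4F = C 0F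
pentagonPart 5F = C 1F
pentagonPart 6F = C 2F

pentagonIndex : Part → Fin 7
pentagonIndex A      = 0F
pentagonIndex (B 0F) = 1F
pentagonIndex (B 1F) = 2F
pentagonIndex (B 2F) = 3F
pentagonIndex (C 0F) = 4F
pentagonIndex (C 1F) = 5F
pentagonIndex (C 2F) = 6F
pentagonIndex F      = 0F

pentagonIndex-pentagonPart : ∀ i → pentagonIndex (pentagonPart i) ≡ i
pentagonIndex-pentagonPart 0F = refl
pentagonIndex-pentagonPart 1F = refl
pentagonIndex-pentagonPart 2F = refl
pentagonIndex-pentagonPart 3F = refl
pentagonIndex-pentagonPart 4F = refl
pentagonIndex-pentagonPart 5F = refl
pentagonIndex-pentagonPart 6F = refl

pentagonPart-injective : Injective _≡_ _≡_ pentagonPart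
pentagonPart-injective {i} {j} e = begin
  i                             ≡⟨ sym (pentagonIndex-pentagonPart i) ⟩
  pentagonIndex (pentagonPart i) ≡⟨ cong pentagonIndex e ⟩
  pentagonIndex (pentagonPart j) ≡⟨ pentagonIndex-pentagonPart j ⟩
  j                             ∎
  where open ≡-Reasoning

pentagon3-partAdj : ∀ js i j → i ≢ j → partAdj js (pentagonPart i) (pentagonPart j) ≡ pentagon3 i j
pentagon3-partAdj = toWitness {a? = all? λ js → all? λ i → all? λ j →
  ¬? (i ≟ j) →-dec partAdj js (pentagonPart i) (pentagonPart j) ≟ᵇ pentagon3 i j} tt

module FiveBasketProperties {G : Graph} (fb : FiveBasket G) where
  open FiveBasket fb

  part≢ : ∀ {v P Q} → part v ≡ P → P ≢ Q → part v ≢ Q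
  part≢ pv P≢Q e = P≢Q (trans (sym pv) e)

  F-adjacent : ∀ {u v Q} → part u ≡ F → part v ≡ Q → Q ≢ B jstar → Q ≢ C jstar → Q ≢ F → E G u v
  F-adjacent pu pv ≢B ≢C ≢F = F-complete _ _ pu (part≢ pv ≢B) (part≢ pv ≢C) (part≢ pv ≢F)

  adj-partAdj : ∀ {u v} P Q → part u ≡ P → part v ≡ Q → u ≢ v → ¬ Open istar P Q →
                adj G u v ≡ partAdj jstar P Q
  adj-partAdj A     A     pu pv u≢v _   = clique A _ _ pu pv u≢v
  adj-partAdj A     (B i) pu pv _ ¬open = AB i (λ { refl → ¬open A-B }) _ _ pu pv
  adj-partAdj A     (C i) pu pv _ _     = AC i _ _ pu pv
  adj-partAdj A     F     pu pv _ _     = adj-swap G (F-adjacent pv pu (λ ()) (λ ()) (λ ()))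
  adj-partAdj (B i) A     pu pv _ ¬open = adj-swap G (AB i (λ { refl → ¬open B-A }) _ _ pv pu)
  adj-partAdj (B i) (B j) pu pv u≢v _ with i ≟ j
  ... | yes refl = clique (B i) _ _ pu pv u≢v
  ... | no i≢j   = BB i j i≢j _ _ pu pv
  adj-partAdj (B i) (C j) pu pv _ _ with i ≟ j
  ... | yes refl = BC-same i _ _ pu pv
  ... | no i≢j   = BC-diff i j i≢j _ _ pu pv
  adj-partAdj (B i) F     pu pv _ _ with i ≟ jstar
  ... | yes refl = adj-swap G (F-antiB _ _ pv pu)
  ... | no i≢j*  = adj-swap G (F-adjacent pv pu (λ { refl → i≢j* refl }) (λ ()) (λ ()))
  adj-partAdj (C i) A     pu pv _ _     = adj-swap G (AC i _ _ pv pu)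
  adj-partAdj (C i) (B j) pu pv _ _ with i ≟ j
  ... | yes refl = adj-swap G (BC-same i _ _ pv pu)
  ... | no i≢j   = adj-swap G (BC-diff j i (i≢j ∘ sym) _ _ pv pu)
  adj-partAdj (C i) (C j) pu pv u≢v _ with i ≟ j
  ... | yes refl = clique (C i) _ _ pu pv u≢v
  ... | no i≢j   = CC i j i≢j _ _ pu pv
  adj-partAdj (C i) F     pu pv _ _ with i ≟ jstar
  ... | yes refl = adj-swap G (F-antiC _ _ pv pu)
  ... | no i≢j*  = adj-swap G (F-adjacent pv pu (λ ()) (λ { refl → i≢j* refl }) (λ ()))
  adj-partAdj F     A     pu pv _ _     = F-adjacent pu pv (λ ()) (λ ()) (λ ())
  adj-partAdj F     (B j) pu pv _ _ with j ≟ jstar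
  ... | yes refl = F-antiB _ _ pu pv
  ... | no j≢j*  = F-adjacent pu pv (λ { refl → j≢j* refl }) (λ ()) (λ ())
  adj-partAdj F     (C j) pu pv _ _ with j ≟ jstar
  ... | yes refl = F-antiC _ _ pu pv
  ... | no j≢j*  = F-adjacent pu pv (λ ()) (λ { refl → j≢j* refl }) (λ ())
  adj-partAdj F     F     pu pv u≢v _   = clique F _ _ pu pv u≢v

  A-nested : ∀ {a a'} → part a ≡ A → part a' ≡ A →
             NbhdSubset (adj G) (λ b → part b ≡ B istar) a a' ⊎
             NbhdSubset (adj G) (λ b → part b ≡ B istar) a' a
  A-nested pa pa' with order-onto _ pa | order-onto _ pa'
  ... | k , refl | k' , refl with ≤ᶠ-total k k'
  ... | inj₁ k≤k' = inj₂ (order-mono k k' k≤k')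
  ... | inj₂ k'≤k = inj₁ (order-mono k' k k'≤k)

  shaped : BasketShaped (adj G) part istar jstar
  shaped = record { adjacent-partAdj = adj-partAdj _ _ ; A-nested = A-nested }

  -- Phrased with ≡ rather than True: checking refl runs the search far faster than checking tt.
  free : ∀ {k} (H : Fin k → Fin k → Bool) → ⌊ refuted? H ⌋ ≡ true → Free H G
  free H refuted (f , f-injective , f-adj) =
    BasketSearch.refuted-sound H istar jstar (toWitness (Equivalence.from T-≡ refuted) istar jstar)
      (part ∘ f) (BasketShaped-induced f f-injective f-adj shaped)

  a₁ : Fin (n G)
  a₁ = order 0F

  a₁∈A : part a₁ ≡ A
  a₁∈A = order-in 0F

  a₁-complete-B : ∀ {j v} → part v ≡ B j → E G a₁ v
  a₁-complete-B {j} pv with j ≟ istar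
  ... | yes refl = order-first _ pv
  ... | no j≢i*  = AB j j≢i* _ _ a₁∈A pv

  b : Fin 3 → Fin (n G)
  b i = proj₁ (B-ne i)

  b∈B : ∀ i → part (b i) ≡ B i
  b∈B i = proj₂ (B-ne i)

  c : Fin 3 → Fin (n G)
  c i = proj₁ (C-ne i)

  c∈C : ∀ i → part (c i) ≡ C i
  c∈C i = proj₂ (C-ne i)

  nonadjacent : ∀ {u v P Q} → part u ≡ P → part v ≡ Q → P ≢ Q → adj G u v ≡ false → coE G u v
  nonadjacent pu pv P≢Q uv = distinct-labels part pu pv P≢Q , uv

  C-to-a₁ : ∀ {i v} → part v ≡ C i → coE G v a₁
  C-to-a₁ {i} pv = nonadjacent pv a₁∈A (λ ()) (adj-swap G (AC i _ _ a₁∈A pv))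

  to-a₁-via-C : ∀ {i v P} → part v ≡ P → P ≢ C i → adj G v (c i) ≡ false → Reach (coE G) v a₁
  to-a₁-via-C {i} pv P≢C vc = there (nonadjacent pv (c∈C i) P≢C vc) (there (C-to-a₁ (c∈C i)) here)

  to-a₁ : ∀ v → Reach (coE G) v a₁
  to-a₁ v with part v in pv
  ... | A   = to-a₁-via-C pv (λ ()) (AC 0F _ _ pv (c∈C 0F))
  ... | B i = to-a₁-via-C pv (λ ()) (BC-diff i _ (punchInᵢ≢i i 0F ∘ sym) _ _ pv (c∈C _))
  ... | C i = there (C-to-a₁ pv) here
  ... | F   = to-a₁-via-C pv (λ ()) (F-antiC _ _ pv (c∈C jstar))

  anticonnected : Anticonnected G
  anticonnected = connected-via-hub (coE-sym G) to-a₁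

  A-adjacent-other-B : ∀ {v} → part v ≡ A → ∀ l → E G v (b (punchIn istar l))
  A-adjacent-other-B pv l = AB _ (punchInᵢ≢i istar l) _ _ pv (b∈B _)

  F-adjacent-other-B : ∀ {v} → part v ≡ F → ∀ l → E G v (b (punchIn jstar l))
  F-adjacent-other-B pv l = F-adjacent pv (b∈B _) (punchInᵢ≢i jstar l ∘ B-injective) (λ ()) (λ ())

  other-Bs-distinct : ∀ k → b (punchIn k 0F) ≢ b (punchIn k 1F)
  other-Bs-distinct k = distinct-labels part (b∈B _) (b∈B _) (punchIn-0≢1 k ∘ B-injective)

  other-Bs-nonadjacent : ∀ k → adj G (b (punchIn k 0F)) (b (punchIn k 1F)) ≡ false
  other-Bs-nonadjacent k = BB _ _ (punchIn-0≢1 k) _ _ (b∈B _) (b∈B _)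

  not-simplicial : ∀ v → ¬ Simplicial G v
  not-simplicial v with part v in pv
  ... | A   = ¬simplicial G (A-adjacent-other-B pv 0F) (A-adjacent-other-B pv 1F)
                (other-Bs-distinct istar) (other-Bs-nonadjacent istar)
  ... | B i = ¬simplicial G (BC-same i _ _ pv (c∈C i)) (adj-swap G (a₁-complete-B pv))
                (distinct-labels part (c∈C i) a₁∈A λ ()) (adj-swap G (AC i _ _ a₁∈A (c∈C i)))
  ... | C i = ¬simplicial G (adj-swap G (BC-same i _ _ (b∈B i) pv))
                (CC i _ (punchInᵢ≢i i 0F ∘ sym) _ _ pv (c∈C _))
                (distinct-labels part (b∈B i) (c∈C _) λ ())
                (BC-diff i _ (punchInᵢ≢i i 0F ∘ sym) _ _ (b∈B i) (c∈C _))
  ... | F   = ¬simplicial G (F-adjacent-other-B pv 0F) (F-adjacent-other-B pv 1F)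
                (other-Bs-distinct jstar) (other-Bs-nonadjacent jstar)

  not-universal : ∀ v → ¬ Universal G v
  not-universal v with part v in pv
  ... | A   = ¬universal G (distinct-labels part (c∈C 0F) pv λ ()) (AC 0F _ _ pv (c∈C 0F))
  ... | B i = ¬universal G (distinct-labels part (b∈B _) pv (punchInᵢ≢i i 0F ∘ B-injective))
                (BB i _ (punchInᵢ≢i i 0F ∘ sym) _ _ pv (b∈B _))
  ... | C i = ¬universal G (distinct-labels part a₁∈A pv λ ()) (adj-swap G (AC i _ _ a₁∈A pv))
  ... | F   = ¬universal G (distinct-labels part (b∈B jstar) pv λ ()) (F-antiB _ _ pv (b∈B jstar))

  adj-partAdj-at-a₁ : ∀ {u v P Q} → part u ≡ P → part v ≡ Q → u ≢ v →
                      (P ≡ A → u ≡ a₁) → (Q ≡ A → v ≡ a₁) → adj G u v ≡ partAdj jstar P Q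
  adj-partAdj-at-a₁ {P = P} {Q} pu pv u≢v u-a₁ v-a₁ with open? istar P Q
  ... | no ¬open = adj-partAdj P Q pu pv u≢v ¬open
  ... | yes A-B  = subst (λ w → E G w _) (sym (u-a₁ refl)) (a₁-complete-B pv)
  ... | yes B-A  = adj-swap G (subst (λ w → E G w _) (sym (v-a₁ refl)) (a₁-complete-B pu))

  pentagonVertex : ∀ i → ∃ λ v → part v ≡ pentagonPart i
  pentagonVertex 0F = a₁ , a₁∈A
  pentagonVertex 1F = B-ne 0F
  pentagonVertex 2F = B-ne 1F
  pentagonVertex 3F = B-ne 2F
  pentagonVertex 4F = C-ne 0F
  pentagonVertex 5F = C-ne 1F
  pentagonVertex 6F = C-ne 2F

  vertex : Fin 7 → Fin (n G)
  vertex i = proj₁ (pentagonVertex i)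

  vertex∈ : ∀ i → part (vertex i) ≡ pentagonPart i
  vertex∈ i = proj₂ (pentagonVertex i)

  vertex-injective : Injective _≡_ _≡_ vertex
  vertex-injective {i} {j} e =
    pentagonPart-injective (trans (sym (vertex∈ i)) (trans (cong part e) (vertex∈ j)))

  vertex-A-is-a₁ : ∀ i → pentagonPart i ≡ A → vertex i ≡ a₁
  vertex-A-is-a₁ i e = cong vertex (pentagonPart-injective e)

  pentagon : InducedCopy pentagon3 G
  pentagon = vertex , vertex-injective , λ i j i≢j →
    trans (adj-partAdj-at-a₁ (vertex∈ i) (vertex∈ j) (i≢j ∘ vertex-injective)
                             (vertex-A-is-a₁ i) (vertex-A-is-a₁ j))
          (pentagon3-partAdj jstar i j i≢j)

proposition5p2 : (G : Graph) → FiveBasket G →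
    (Free twoP3 G × Free C4 G × Free C6 G × Free C7 G × Free T0 G)
    × InducedCopy pentagon3 G
    × Anticonnected G
    × (∀ v → ¬ Simplicial G v)
    × (∀ v → ¬ Universal G v)
proposition5p2 G fb =
  (free twoP3 refl , free C4 refl , free C6 refl , free C7 refl , free T0 refl)
  , pentagon , anticonnected , not-simplicial , not-universal
  where open FiveBasketProperties fb
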